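{- Let $G$ be a distance critical graph, let $z \in V(G)$, and let $x,y$ be distinct nonadjacent vertices of $G$. If $z$ has no determining pair in $G + xy$, then either $\{x,y\}$ is the only determining pair for $z$ in $G$, or every determining pair for $z$ in $G$ intersects $\{x,y\}$.
   Context: All graphs are finite, simple and undirected. For vertices $x,y$ of a graph $G$, $d_G(x,y)$ is the length of a shortest path from $x$ to $y$ in $G$ ($\infty$ if none exists). A graph $G$ is distance critical if for every vertex $v \in V(G)$ there exist vertices $x,y \in V(G)\setminus\{v\}$ with $d_G(x,y) \neq d_{G-v}(x,y)$. A pair of vertices $\{a,b\}$ is a determining pair for a vertex $v$ (in a given graph) if $a$ and $b$ are distinct and nonadjacent and $v$ is their unique common neighbor. $G+xy$ denotes $G$ with the edge $xy$ added. -}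

module Defs where

open import Data.Nat using (ℕ; zero; suc; _≤_)
open import Data.Fin using (Fin; _≟_)
open import Data.Bool using (Bool; true; false; _∧_; _∨_; not)
open import Data.Maybe using (Maybe; just; nothing)
open import Data.Product using (Σ; _×_; _,_; ∃-syntax)
open import Data.Sum using (_⊎_)
open import Relation.Nullary using (¬_)
open import Relation.Nullary.Decidable using (⌊_⌋)
open import Relation.Binary.PropositionalEquality using (_≡_; _≢_)

AdjRel : ℕ → Set
AdjRel n = Fin n → Fin n → Bool

record Graph (n : ℕ) : Set where
  field
    adj    : AdjRel n
    sym    : ∀ u v → adj u v ≡ adj v u
    irrefl : ∀ v → adj v v ≡ false
open Graph public

addEdge : ∀ {n} → AdjRel n → Fin n → Fin n → AdjRel n
addEdge A x y u v = A u v ∨ ((⌊ u ≟ x ⌋ ∧ ⌊ v ≟ y ⌋) ∨ (⌊ u ≟ y ⌋ ∧ ⌊ v ≟ x ⌋))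

-- Realised on the same vertex set by removing
-- all edges at v (v becomes isolated); for vertices x, y ≠ v, walks and
-- hence distances are exactly those of the vertex-deleted graph G - v.
deleteVertex : ∀ {n} → AdjRel n → Fin n → AdjRel n
deleteVertex A v u w = A u w ∧ not ⌊ u ≟ v ⌋ ∧ not ⌊ w ≟ v ⌋

data Walk {n} (A : AdjRel n) : Fin n → Fin n → ℕ → Set where
  nil  : ∀ {u} → Walk A u u zero
  cons : ∀ {u v w k} → A u v ≡ true → Walk A v w k → Walk A u w (suc k)

-- Dist A x y d : the distance from x to y is d (nothing = ∞).
Dist : ∀ {n} → AdjRel n → Fin n → Fin n → Maybe ℕ → Set
Dist A x y (just k) = Walk A x y k × (∀ j → Walk A x y j → k ≤ j)
Dist A x y nothing  = ∀ j → ¬ Walk A x y j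

DistChanges : ∀ {n} → AdjRel n → Fin n → Fin n → Fin n → Set
DistChanges A v x y =
  ∃[ d₁ ] ∃[ d₂ ] (Dist A x y d₁ × Dist (deleteVertex A v) x y d₂ × d₁ ≢ d₂)

DistanceCritical : ∀ {n} → Graph n → Set
DistanceCritical {n} G =
  ∀ (v : Fin n) → ∃[ x ] ∃[ y ] (x ≢ v × y ≢ v × DistChanges (adj G) v x y)

DeterminingPair : ∀ {n} → AdjRel n → Fin n → Fin n → Fin n → Set
DeterminingPair A v a b =
  a ≢ b × A a b ≡ false × A a v ≡ true × A b v ≡ true ×
  (∀ w → A a w ≡ true → A b w ≡ true → w ≡ v)

SamePair : ∀ {n} → Fin n → Fin n → Fin n → Fin n → Set
SamePair a b x y = (a ≡ x × b ≡ y) ⊎ (a ≡ y × b ≡ x)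

Meets : ∀ {n} → Fin n → Fin n → Fin n → Fin n → Set
Meets a b x y = (a ≡ x ⊎ a ≡ y) ⊎ (b ≡ x ⊎ b ≡ y)

{-# OPTIONS --safe #-}
module Submission where

open import Defs
open import Data.Nat using (ℕ)
open import Data.Fin using (Fin; _≟_)
open import Data.Bool using (false)
open import Data.Bool.Properties using (∨-identityʳ)
open import Data.Product using (_×_; _,_)
open import Data.Sum using (_⊎_; inj₁; inj₂)
open import Data.Empty using (⊥-elim)
open import Function using (_∘_)
open import Relation.Nullary using (¬_; Dec; yes; no)
open import Relation.Nullary.Decidable using (_⊎-dec_; decidable-stable)
open import Relation.Binary.PropositionalEquality as ≡ using (_≡_; _≢_; trans)

-- Adding xy only changes the rows of x and y, so a determining pair for z
-- disjoint from {x,y} would still determine z in G + xy; hence every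
-- determining pair meets {x,y}.

Meets? : ∀ {n} (a b x y : Fin n) → Dec (Meets a b x y)
Meets? a b x y = (a ≟ x ⊎-dec a ≟ y) ⊎-dec (b ≟ x ⊎-dec b ≟ y)

addEdge-row : ∀ {n} (A : AdjRel n) {x y u : Fin n} → ¬ (u ≡ x ⊎ u ≡ y) →
  ∀ v → addEdge A x y u v ≡ A u v
addEdge-row A {x} {y} {u} u∉xy v with u ≟ x | u ≟ y
... | yes u≡x | _       = ⊥-elim (u∉xy (inj₁ u≡x))
... | no _    | yes u≡y = ⊥-elim (u∉xy (inj₂ u≡y))
... | no _    | no _    = ∨-identityʳ (A u v)

determiningPair-resp-rows : ∀ {n} {A B : AdjRel n} {v a b : Fin n} →
  (∀ w → B a w ≡ A a w) → (∀ w → B b w ≡ A b w) →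
  DeterminingPair A v a b → DeterminingPair B v a b
determiningPair-resp-rows {v = v} {b = b} rowᵃ rowᵇ (a≢b , ab , av , bv , unique) =
  a≢b
  , trans (rowᵃ b) ab
  , trans (rowᵃ v) av
  , trans (rowᵇ v) bv
  , λ w aw bw → unique w (trans (≡.sym (rowᵃ w)) aw) (trans (≡.sym (rowᵇ w)) bw)

lemma3p7 : ∀ {n : ℕ} (G : Graph n) → DistanceCritical G →
    (z x y : Fin n) → x ≢ y → adj G x y ≡ false →
    (∀ a b → ¬ DeterminingPair (addEdge (adj G) x y) z a b) →
    (DeterminingPair (adj G) z x y
    × (∀ a b → DeterminingPair (adj G) z a b → SamePair a b x y))
    ⊎ (∀ a b → DeterminingPair (adj G) z a b → Meets a b x y)
lemma3p7 G _ z x y _ _ noDP = inj₂ meets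
  where
  meets : ∀ a b → DeterminingPair (adj G) z a b → Meets a b x y
  meets a b dp = decidable-stable (Meets? a b x y) λ disjoint →
    noDP a b (determiningPair-resp-rows
      (addEdge-row (adj G) (disjoint ∘ inj₁))
      (addEdge-row (adj G) (disjoint ∘ inj₂))
      dp)
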